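{- Let $\lambda=(\lambda_1,\dots,\lambda_t)$ be an unrefinable partition into distinct parts and let $\mu_1<\mu_2<\dots<\mu_m$ be its missing parts. Then $m\le \lfloor \lambda_t/2\rfloor$.
   Context: A partition of $N$ into distinct parts is a sequence of positive integers $\lambda_1<\lambda_2<\dots<\lambda_t$ with $t\ge 2$ and $\sum_i\lambda_i=N$. Its missing parts are the elements of $\mathcal M_\lambda=\{1,2,\dots,\lambda_t\}\setminus\{\lambda_1,\dots,\lambda_t\}$, listed as $\mu_1<\dots<\mu_m$ ($m\ge 0$). The partition is refinable if there exist a part $\lambda_\ell$ and indices $1\le i<j\le m$ with $\mu_i+\mu_j=\lambda_\ell$; otherwise it is unrefinable. -}

module Defs where

open import Data.Nat using (ℕ; zero; suc; _+_; _<_; _≤_; _/_)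
open import Data.Nat.Properties using (_≟_)
open import Data.List using (List; []; _∷_; length; filter; upTo; map)
open import Data.List.Membership.Propositional using (_∈_; _∉_)
open import Data.List.Membership.DecPropositional _≟_ using (_∉?_)
open import Data.List.Relation.Unary.All using (All)
open import Data.List.Relation.Unary.Linked using (Linked)
open import Data.Product using (_×_; ∃-syntax)
open import Relation.Nullary using (¬_)

record DistinctPartition (λs : List ℕ) : Set where
  field
    increasing : Linked _<_ λs
    positive   : All (λ p → 0 < p) λs
    atLeastTwo : 2 ≤ length λs

lastPart : List ℕ → ℕ
lastPart []           = 0
lastPart (x ∷ [])     = x
lastPart (_ ∷ y ∷ ys) = lastPart (y ∷ ys)

oneTo : ℕ → List ℕ
oneTo n = map suc (upTo n)

missingParts : List ℕ → List ℕ
missingParts λs = filter (_∉? λs) (oneTo (lastPart λs))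

Refinable : List ℕ → Set
Refinable λs = ∃[ a ] ∃[ b ] (a ∈ missingParts λs × b ∈ missingParts λs × a < b × (a + b) ∈ λs)

Unrefinable : List ℕ → Set
Unrefinable λs = ¬ Refinable λs

{-# OPTIONS --safe #-}
module Submission where

-- Every missing part a lies strictly between 0 and L = λₜ, and L is itself a part.
-- Folding a ↦ min(a, L − a) sends the missing parts into {1, …, ⌊L/2⌋}, and two
-- distinct missing parts with the same image would sum to L, refining λ.
-- So for an unrefinable λ the fold is injective and m ≤ ⌊L/2⌋ by pigeonhole.

open import Defs
open import Data.Nat using (ℕ; suc; pred; _+_; _*_; _∸_; _⊓_; _≤_; _<_; _/_; s≤s; z≤n; >-nonZero)
open import Data.Nat.Properties
open import Data.Nat.DivMod using (m*n/n≡m; /-monoˡ-≤)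
open import Data.List using (List; []; _∷_; length; lookup)
open import Data.List.Membership.Propositional using (_∈_)
open import Data.List.Membership.Propositional.Properties using (∈-lookup; ∈-filter⁻; ∈-map⁻; ∈-upTo⁻)
open import Data.List.Membership.DecPropositional _≟_ using (_∉?_)
open import Data.List.Relation.Unary.Any using (here; there)
import Data.List.Relation.Unary.All as All
open import Data.List.Relation.Unary.AllPairs using (_∷_)
open import Data.List.Relation.Unary.Unique.Propositional using (Unique)
import Data.List.Relation.Unary.Unique.Propositional.Properties as Unique
open import Data.Fin as Fin using (Fin; zero; suc; fromℕ<)
open import Data.Fin.Properties using (pigeonhole; fromℕ<-injective)
open import Data.Product using (_×_; _,_; proj₂)
open import Data.Sum using (_⊎_; inj₁; inj₂)
open import Relation.Nullary using (contradiction)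
open import Relation.Binary.PropositionalEquality
  using (_≡_; _≢_; refl; sym; trans; cong; cong₂; subst; module ≡-Reasoning)
open import Relation.Binary.Definitions using (tri<; tri≈; tri>)

Unique-lookup-≢ : ∀ {A : Set} {xs : List A} → Unique xs →
  ∀ {i j : Fin (length xs)} → i Fin.< j → lookup xs i ≢ lookup xs j
Unique-lookup-≢ {xs = _ ∷ _} (x∉ ∷ _) {zero} {suc j} _ = All.lookup x∉ (∈-lookup j)
Unique-lookup-≢ {xs = _ ∷ _} (_ ∷ u) {suc i} {suc j} (s≤s i<j) = Unique-lookup-≢ u i<j

injection-length-≤ : ∀ {xs : List ℕ} k (f : ℕ → ℕ) → Unique xs →
  (∀ {x} → x ∈ xs → 0 < f x × f x ≤ k) →
  (∀ {x y} → x ∈ xs → y ∈ xs → f x ≡ f y → x ≡ y) →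
  length xs ≤ k
injection-length-≤ {xs} k f uniq range inj = ≮⇒≥ λ k<length →
  let i , j , i<j , code≡ = pigeonhole k<length code in
  contradiction (inj (∈-lookup i) (∈-lookup j) (code-injective code≡)) (Unique-lookup-≢ uniq i<j)
  where
  value : Fin (length xs) → ℕ
  value i = f (lookup xs i)

  value-positive : ∀ i → 0 < value i
  value-positive i with range (∈-lookup i)
  ... | 0<fx , _ = 0<fx

  pred-value<k : ∀ i → pred (value i) < k
  pred-value<k i with range (∈-lookup i)
  ... | 0<fx , fx≤k = ≤-trans (≤-reflexive (suc-pred _ {{>-nonZero 0<fx}})) fx≤k

  code : Fin (length xs) → Fin k
  code i = fromℕ< (pred-value<k i)

  code-injective : ∀ {i j} → code i ≡ code j → value i ≡ value j
  code-injective {i} {j} eq =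
    pred-injective {{>-nonZero (value-positive i)}} {{>-nonZero (value-positive j)}}
      (fromℕ<-injective _ _ (pred-value<k i) (pred-value<k j) eq)

fold : ℕ → ℕ → ℕ
fold n a = a ⊓ (n ∸ a)

fold-≤ : ∀ n a → fold n a ≤ n
fold-≤ n a = ≤-trans (m⊓n≤n a (n ∸ a)) (m∸n≤m n a)

fold-positive : ∀ {n a} → 0 < a → a < n → 0 < fold n a
fold-positive 0<a a<n = ⊓-glb 0<a (m<n⇒0<n∸m a<n)

fold-≤-half : ∀ {n a} → a ≤ n → fold n a ≤ n / 2
fold-≤-half {n} {a} a≤n = begin
  fold n a          ≡⟨ m*n/n≡m (fold n a) 2 ⟨
  fold n a * 2 / 2  ≤⟨ /-monoˡ-≤ 2 twice-fold≤n ⟩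
  n / 2             ∎
  where
  open ≤-Reasoning
  twice-fold≤n : fold n a * 2 ≤ n
  twice-fold≤n = begin
    fold n a * 2              ≡⟨ *-comm (fold n a) 2 ⟩
    fold n a + (fold n a + 0) ≡⟨ cong (fold n a +_) (+-identityʳ (fold n a)) ⟩
    fold n a + fold n a       ≤⟨ +-mono-≤ (m⊓n≤m a (n ∸ a)) (m⊓n≤n a (n ∸ a)) ⟩
    a + (n ∸ a)               ≡⟨ m+[n∸m]≡n a≤n ⟩
    n                         ∎

unfold : ∀ {n a} → a ≤ n → a ≡ fold n a ⊎ a ≡ n ∸ fold n a
unfold {n} {a} a≤n with ⊓-sel a (n ∸ a)
... | inj₁ fold≡a = inj₁ (sym fold≡a)
... | inj₂ fold≡n∸a = inj₂ (trans (sym (m∸[m∸n]≡n a≤n)) (cong (n ∸_) (sym fold≡n∸a)))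

fold-injective : ∀ {n a b} → a ≤ n → b ≤ n → fold n a ≡ fold n b → a ≡ b ⊎ a + b ≡ n
fold-injective {n} {a} {b} a≤n b≤n fold≡ with unfold a≤n | unfold b≤n
... | inj₁ a≡c | inj₁ b≡c = inj₁ (trans a≡c (trans fold≡ (sym b≡c)))
... | inj₂ a≡n∸c | inj₂ b≡n∸c = inj₁ (trans a≡n∸c (trans (cong (n ∸_) fold≡) (sym b≡n∸c)))
... | inj₁ a≡c | inj₂ b≡n∸c = inj₂ (begin
  a + b                     ≡⟨ cong₂ _+_ (trans a≡c fold≡) b≡n∸c ⟩
  fold n b + (n ∸ fold n b) ≡⟨ m+[n∸m]≡n (fold-≤ n b) ⟩
  n                         ∎)
  where open ≡-Reasoning
... | inj₂ a≡n∸c | inj₁ b≡c = inj₂ (begin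
  a + b                     ≡⟨ cong₂ _+_ a≡n∸c (trans b≡c (sym fold≡)) ⟩
  (n ∸ fold n a) + fold n a ≡⟨ m∸n+n≡m (fold-≤ n a) ⟩
  n                         ∎)
  where open ≡-Reasoning

lastPart-∈ : ∀ x xs → lastPart (x ∷ xs) ∈ x ∷ xs
lastPart-∈ x []       = here refl
lastPart-∈ x (y ∷ ys) = there (lastPart-∈ y ys)

missingParts-unique : ∀ λs → Unique (missingParts λs)
missingParts-unique λs =
  Unique.filter⁺ (_∉? λs) (Unique.map⁺ suc-injective (Unique.upTo⁺ (lastPart λs)))

missingPart-range : ∀ x xs {a} → a ∈ missingParts (x ∷ xs) → 0 < a × a < lastPart (x ∷ xs)
missingPart-range x xs a∈ with ∈-filter⁻ (_∉? x ∷ xs) {xs = oneTo (lastPart (x ∷ xs))} a∈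
... | a∈oneTo , a∉ with ∈-map⁻ suc a∈oneTo
... | k , k∈upTo , refl =
  s≤s z≤n , ≤∧≢⇒< (∈-upTo⁻ k∈upTo) (λ a≡L → a∉ (subst (_∈ x ∷ xs) (sym a≡L) (lastPart-∈ x xs)))

Unrefinable⇒missing-sum-∈⇒≡ : ∀ {λs a b} → Unrefinable λs →
  a ∈ missingParts λs → b ∈ missingParts λs → a + b ∈ λs → a ≡ b
Unrefinable⇒missing-sum-∈⇒≡ {λs} {a} {b} unrefinable a∈ b∈ a+b∈ with <-cmp a b
... | tri< a<b _ _ = contradiction (a , b , a∈ , b∈ , a<b , a+b∈) unrefinable
... | tri≈ _ a≡b _ = a≡b
... | tri> _ _ b<a = contradiction (b , a , b∈ , a∈ , b<a , subst (_∈ λs) (+-comm a b) a+b∈) unrefinable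

lemma2p3 : (λs : List ℕ) → DistinctPartition λs → Unrefinable λs →
    length (missingParts λs) ≤ lastPart λs / 2
lemma2p3 [] dp _ = contradiction (DistinctPartition.atLeastTwo dp) λ ()
lemma2p3 λs@(x ∷ xs) _ unrefinable =
  injection-length-≤ (L / 2) (fold L) (missingParts-unique λs) folded-range folded-injective
  where
  L = lastPart λs

  missing≤L : ∀ {a} → a ∈ missingParts λs → a ≤ L
  missing≤L a∈ = <⇒≤ (proj₂ (missingPart-range x xs a∈))

  folded-range : ∀ {a} → a ∈ missingParts λs → 0 < fold L a × fold L a ≤ L / 2
  folded-range a∈ with missingPart-range x xs a∈
  ... | 0<a , a<L = fold-positive 0<a a<L , fold-≤-half (<⇒≤ a<L)

  folded-injective : ∀ {a b} → a ∈ missingParts λs → b ∈ missingParts λs →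
                     fold L a ≡ fold L b → a ≡ b
  folded-injective a∈ b∈ fold≡ with fold-injective (missing≤L a∈) (missing≤L b∈) fold≡
  ... | inj₁ a≡b   = a≡b
  ... | inj₂ a+b≡L =
    Unrefinable⇒missing-sum-∈⇒≡ unrefinable a∈ b∈ (subst (_∈ λs) (sym a+b≡L) (lastPart-∈ x xs))
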